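{- Let $k\ge2$, $m_1\ge\dots\ge m_k\ge1$, and let $H$ be a connected subgraph of $K_{m_1,\dots,m_k}$ with at least two vertices which is isometrically embedded in $K_{m_1,\dots,m_k}$. Then $H$ is a complete $p$-partite graph $K_{n_1,\dots,n_p}$ with $p\ge2$ and $n_1\ge\dots\ge n_p\ge1$ such that there exist indices $1\le i_1<\dots<i_p\le k$ with $n_j\le m_{i_j}$ for all $1\le j\le p$.
   Context: The complete $k$-partite graph $K_{m_1,\dots,m_k}$ has vertex set the disjoint union of sets $V_1,\dots,V_k$ with $|V_i|=m_i$, two vertices adjacent iff they lie in different parts. A subgraph $H=(V',E')$ of $G=(V,E)$ ($V'\subset V$, $E'\subset E$) is isometrically embedded if $d_H(x,y)=d_G(x,y)$ for all $x,y\in V'$, where $d$ denotes graph distance. -}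

module Defs where

open import Data.Nat using (ℕ; zero; suc; _≤_)
open import Data.Fin using (Fin) renaming (_≤_ to _≤ᶠ_; _<_ to _<ᶠ_)
open import Data.Bool using (Bool; true)
open import Data.Product using (Σ; _×_; ∃; ∃-syntax; _,_; proj₁)
open import Relation.Binary.PropositionalEquality using (_≡_)
open import Relation.Nullary using (¬_)
open import Function.Bundles using (_↔_; _⇔_; Inverse)

data Walk {V : Set} (Adj : V → V → Set) : V → V → ℕ → Set where
  here : ∀ {x} → Walk Adj x x zero
  step : ∀ {x z y n} → Adj x z → Walk Adj z y n → Walk Adj x y (suc n)

Dist : {V : Set} → (V → V → Set) → V → V → ℕ → Set
Dist Adj x y d = Walk Adj x y d × (∀ n → Walk Adj x y n → d ≤ n)

-- Complete multipartite graph K_{m_1,...,m_k}: vertex (i , a) is vertex a of part V_i.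
KVtx : (k : ℕ) → (Fin k → ℕ) → Set
KVtx k m = Σ (Fin k) (λ i → Fin (m i))

KAdj : {k : ℕ} {m : Fin k → ℕ} → KVtx k m → KVtx k m → Set
KAdj (i , _) (j , _) = ¬ (i ≡ j)

-- A subgraph H = (V', E') of K_{m_1,...,m_k}, given by (finite, decidable)
-- vertex and edge sets; edges are unordered pairs (symmetric relation)
-- that are edges of K with both endpoints in V'.
record Subgraph (k : ℕ) (m : Fin k → ℕ) : Set where
  field
    VH   : KVtx k m → Bool
    EH   : KVtx k m → KVtx k m → Bool
    sym  : ∀ x y → EH x y ≡ true → EH y x ≡ true
    ends : ∀ x y → EH x y ≡ true → (VH x ≡ true) × (VH y ≡ true)
    sub  : ∀ x y → EH x y ≡ true → KAdj {k} {m} x y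

module _ {k : ℕ} {m : Fin k → ℕ} (H : Subgraph k m) where
  open Subgraph H

  HAdj : KVtx k m → KVtx k m → Set
  HAdj x y = EH x y ≡ true

  HVtx : Set
  HVtx = Σ (KVtx k m) (λ x → VH x ≡ true)

  Connected : Set
  Connected = ∀ x y → VH x ≡ true → VH y ≡ true → ∃[ n ] Walk HAdj x y n

  AtLeastTwoVertices : Set
  AtLeastTwoVertices = ∃[ x ] ∃[ y ] (¬ (x ≡ y) × VH x ≡ true × VH y ≡ true)

  Isometric : Set
  Isometric = ∀ x y → VH x ≡ true → VH y ≡ true →
              ∀ d → Dist HAdj x y d ⇔ Dist (KAdj {k} {m}) x y d

  IsoToMultipartite : (p : ℕ) → (Fin p → ℕ) → Set
  IsoToMultipartite p n =
    Σ (HVtx ↔ KVtx p n) (λ f →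
      ∀ u v → (HAdj (proj₁ u) (proj₁ v) ⇔ KAdj {p} {n} (Inverse.to f u) (Inverse.to f v)))

NonIncreasing : {k : ℕ} → (Fin k → ℕ) → Set
NonIncreasing {k} m = ∀ (i j : Fin k) → i ≤ᶠ j → m j ≤ m i

StrictlyIncreasing : {p k : ℕ} → (Fin p → Fin k) → Set
StrictlyIncreasing {p} f = ∀ (i j : Fin p) → i <ᶠ j → f i <ᶠ f j

{-# OPTIONS --safe #-}
module Submission where

open import Defs

open import Axiom.UniquenessOfIdentityProofs.WithK using (uip)
open import Data.Bool using (Bool; true; false; if_then_else_)
open import Data.Bool.Properties using (T-≡)
open import Data.Fin using (Fin; zero; suc; toℕ; inject≤; fromℕ<)
open import Data.Fin.Permutation using (Permutation′; _⟨$⟩ʳ_; _⟨$⟩ˡ_; inverseʳ; transpose; lift₀; _∘ₚ_)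
import Data.Fin.Permutation as Permutation
open import Data.Fin.Properties
  using (+↔⊎; toℕ<n; toℕ≤pred[n]; toℕ-inject≤; toℕ-injective; toℕ-fromℕ<; inject≤-injective; injective⇒≤; <⇒notInjective; ¬∀⟶∃¬)
import Data.Nat as ℕ
open import Data.Nat using (ℕ; _+_; _≤_; _<_; z≤n; s≤s; _≤ᵇ_)
open import Data.Nat.Properties
  using (≤-refl; ≤-reflexive; ≤-trans; <⇒≤; ≰⇒>; ≮⇒≥; _≤?_; _<?_; n<1+n; m<n⇒0<n; ≤ᵇ⇒≤; ≤⇒≤ᵇ; module ≤-Reasoning)
open import Data.Product using (Σ; _×_; ∃-syntax; _,_; proj₁; proj₂; map₂)
open import Data.Product.Function.Dependent.Propositional using (Σ-↔)
open import Data.Sum using (_⊎_; inj₁; inj₂)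
open import Data.Sum.Function.Propositional using (_⊎-↔_)
open import Function using (_∘_)
open import Function.Bundles using (_↔_; _⇔_; Inverse; Injection; Equivalence; mk↔ₛ′; mk⇔)
open import Function.Definitions using (Injective)
open import Function.Properties.Equivalence using () renaming (trans to ⇔-trans)
open import Function.Properties.Inverse using (↔-refl; ↔-sym; ↔-trans; ↔⇒↣)
open import Function.Related.TypeIsomorphisms using (Σ-assoc)
open import Relation.Binary.PropositionalEquality using (_≡_; refl; sym; trans; cong; subst₂)
open import Relation.Nullary using (¬_; yes; no; contradiction)

-- Two vertices of H in different parts of K are at distance 1 in K, hence, H being
-- isometric, adjacent in H; two vertices in the same part are never adjacent. So H is
-- the complete multipartite graph whose parts are the nonempty traces V_i ∩ V(H);
-- list them by decreasing size. The choice i_j = j works: the j largest traces lie in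
-- j distinct parts of K, one of them of index at least j, so as m is non-increasing
-- the j-th largest trace has size at most m_j. Connectivity provides an edge, which
-- joins two different parts, so p ≥ 2.

count : ∀ {M} → (Fin M → Bool) → ℕ
count {ℕ.zero}  P = 0
count {ℕ.suc M} P = (if P zero then 1 else 0) + count (P ∘ suc)

Σ-Fin-suc↔ : ∀ {M} (P : Fin (ℕ.suc M) → Set) → Σ (Fin (ℕ.suc M)) P ↔ (P zero ⊎ Σ (Fin M) (P ∘ suc))
Σ-Fin-suc↔ P = mk↔ₛ′ to from to∘from from∘to
  where
  to : Σ _ P → P zero ⊎ Σ _ (P ∘ suc)
  to (zero  , x) = inj₁ x
  to (suc a , x) = inj₂ (a , x)
  from : P zero ⊎ Σ _ (P ∘ suc) → Σ _ P
  from (inj₁ x)       = zero , x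
  from (inj₂ (a , x)) = suc a , x
  to∘from : ∀ y → to (from y) ≡ y
  to∘from (inj₁ _) = refl
  to∘from (inj₂ _) = refl
  from∘to : ∀ x → from (to x) ≡ x
  from∘to (zero  , _) = refl
  from∘to (suc _ , _) = refl

≡true↔Fin : (b : Bool) → (b ≡ true) ↔ Fin (if b then 1 else 0)
≡true↔Fin false = mk↔ₛ′ (λ ()) (λ ()) (λ ()) (λ ())
≡true↔Fin true  = mk↔ₛ′ (λ _ → zero) (λ _ → refl) (λ { zero → refl ; (suc ()) }) (λ { refl → refl })

enumerate : ∀ {M} (P : Fin M → Bool) → Σ (Fin M) (λ a → P a ≡ true) ↔ Fin (count P)
enumerate {ℕ.zero}  P = mk↔ₛ′ (λ ()) (λ ()) (λ ()) (λ ())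
enumerate {ℕ.suc M} P =
  ↔-trans (Σ-Fin-suc↔ _) (↔-trans (≡true↔Fin (P zero) ⊎-↔ enumerate (P ∘ suc)) (↔-sym +↔⊎))

module _ {M : ℕ} (P : Fin M → Bool) where

  select : Fin (count P) → Fin M
  select = proj₁ ∘ Inverse.from (enumerate P)

  select-true : ∀ j → P (select j) ≡ true
  select-true = proj₂ ∘ Inverse.from (enumerate P)

  select-onto : ∀ a → P a ≡ true → ∃[ j ] select j ≡ a
  select-onto a h =
    Inverse.to (enumerate P) (a , h) , cong proj₁ (Inverse.strictlyInverseʳ (enumerate P) (a , h))

  select-injective : Injective _≡_ _≡_ select
  select-injective eq = Injection.injective (↔⇒↣ (↔-sym (enumerate P))) (proj₁-injective eq)
    where
    proj₁-injective : ∀ {x y : Σ (Fin M) (λ a → P a ≡ true)} → proj₁ x ≡ proj₁ y → x ≡ y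
    proj₁-injective {a , h} {.a , h′} refl = cong (a ,_) (uip h h′)

  count≤ : count P ≤ M
  count≤ = injective⇒≤ select-injective

argmax : ∀ {q} (g : Fin (ℕ.suc q) → ℕ) → ∃[ i ] (∀ j → g j ≤ g i)
argmax {ℕ.zero}  g = zero , λ { zero → ≤-refl }
argmax {ℕ.suc q} g with argmax (g ∘ suc)
... | i , max with g (suc i) ≤? g zero
...   | yes le = zero  , λ { zero → ≤-refl ; (suc j) → ≤-trans (max j) le }
...   | no  gt = suc i , λ { zero → <⇒≤ (≰⇒> gt) ; (suc j) → max j }

descendingPermutation : ∀ {p} (g : Fin p → ℕ) → Σ (Permutation′ p) (λ π → NonIncreasing (λ j → g (π ⟨$⟩ʳ j)))
descendingPermutation {ℕ.zero}  g = Permutation.id , λ ()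
descendingPermutation {ℕ.suc q} g with argmax g
... | i₀ , max with descendingPermutation (λ j → g (transpose zero i₀ ⟨$⟩ʳ suc j))
... | π , π-desc = lift₀ π ∘ₚ transpose zero i₀ , desc
  where
  desc : NonIncreasing (λ j → g (transpose zero i₀ ⟨$⟩ʳ (lift₀ π ⟨$⟩ʳ j)))
  desc zero    j       _         = max _
  desc (suc i) (suc j) (s≤s i≤j) = π-desc i j i≤j

record DescendingSupport {k : ℕ} (s : Fin k → ℕ) : Set where
  field
    size       : ℕ
    index      : Fin size → Fin k
    injective  : Injective _≡_ _≡_ index
    onto       : ∀ i → 1 ≤ s i → ∃[ j ] index j ≡ i
    positive   : ∀ j → 1 ≤ s (index j)
    descending : NonIncreasing (s ∘ index)

descendingSupport : ∀ {k} (s : Fin k → ℕ) → DescendingSupport s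
descendingSupport {k} s = record
  { size       = count positive?
  ; index      = select positive? ∘ (π ⟨$⟩ʳ_)
  ; injective  = Injection.injective (↔⇒↣ π) ∘ select-injective positive?
  ; onto       = index-onto
  ; positive   = λ j → ≤ᵇ⇒≤ 1 _ (Equivalence.from T-≡ (select-true positive? _))
  ; descending = proj₂ (descendingPermutation (s ∘ select positive?))
  }
  where
  positive? : Fin k → Bool
  positive? i = 1 ≤ᵇ s i
  π : Permutation′ (count positive?)
  π = proj₁ (descendingPermutation (s ∘ select positive?))
  index-onto : ∀ i → 1 ≤ s i → ∃[ j ] select positive? (π ⟨$⟩ʳ j) ≡ i
  index-onto i 1≤si with select-onto positive? i (Equivalence.to T-≡ (≤⇒≤ᵇ 1≤si))
  ... | j , select-j≡i = π ⟨$⟩ˡ j , trans (cong (select positive?) (inverseʳ π)) select-j≡i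

injective⇒∃≥ : ∀ {n k} (f : Fin (ℕ.suc n) → Fin k) → Injective _≡_ _≡_ f → ∃[ i ] n ≤ toℕ (f i)
injective⇒∃≥ {n} f f-injective =
  map₂ ≮⇒≥ (¬∀⟶∃¬ (ℕ.suc n) (λ i → toℕ (f i) < n) (λ i → toℕ (f i) <? n) not-all-below)
  where
  not-all-below : ¬ (∀ i → toℕ (f i) < n)
  not-all-below below = <⇒notInjective {f = λ i → fromℕ< (below i)} (n<1+n n) λ eq →
    f-injective (toℕ-injective (trans (sym (toℕ-fromℕ< _)) (trans (cong toℕ eq) (toℕ-fromℕ< _))))

module _ {p k} (f : Fin p → ℕ) (m : Fin k → ℕ) (σ : Fin p → Fin k) (σ-injective : Injective _≡_ _≡_ σ)
         (f-desc : NonIncreasing f) (m-desc : NonIncreasing m) (f≤m∘σ : ∀ j → f j ≤ m (σ j)) where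

  descending-bound : ∀ j → f j ≤ m (inject≤ j (injective⇒≤ σ-injective))
  descending-bound j = bound (injective⇒∃≥ (σ ∘ first) (inject≤-injective _ _ _ _ ∘ σ-injective))
    where
    first : Fin (ℕ.suc (toℕ j)) → Fin p
    first i = inject≤ i (toℕ<n j)
    bound : ∃[ i ] toℕ j ≤ toℕ (σ (first i)) → f j ≤ m (inject≤ j (injective⇒≤ σ-injective))
    bound (i , j≤σi) = begin
      f j              ≤⟨ f-desc (first i) j (≤-trans (≤-reflexive (toℕ-inject≤ i _)) (toℕ≤pred[n] i)) ⟩
      f (first i)      ≤⟨ f≤m∘σ (first i) ⟩
      m (σ (first i))  ≤⟨ m-desc _ _ (≤-trans (≤-reflexive (toℕ-inject≤ j _)) j≤σi) ⟩
      m (inject≤ j _)  ∎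
      where open ≤-Reasoning

Σ-reindex : ∀ {p k} {B : Fin k → Set} (σ : Fin p → Fin k) → Injective _≡_ _≡_ σ →
            (∀ i → B i → ∃[ j ] σ j ≡ i) → Σ (Fin p) (B ∘ σ) ↔ Σ (Fin k) B
Σ-reindex {p} {k} {B} σ σ-injective σ-onto = mk↔ₛ′ to from to∘from from∘to
  where
  to : Σ (Fin p) (B ∘ σ) → Σ (Fin k) B
  to (j , b) = σ j , b
  pull : ∀ i → B i → ∃[ j ] σ j ≡ i → Σ (Fin p) (B ∘ σ)
  pull .(σ j) b (j , refl) = j , b
  from : Σ (Fin k) B → Σ (Fin p) (B ∘ σ)
  from (i , b) = pull i b (σ-onto i b)
  to∘from : ∀ y → to (from y) ≡ y
  to∘from (i , b) with σ-onto i b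
  ... | j , refl = refl
  pull-σ : ∀ j (b : B (σ j)) (c : ∃[ j′ ] σ j′ ≡ σ j) → pull (σ j) b c ≡ (j , b)
  pull-σ j b (j′ , e) with σ-injective e
  pull-σ j b (.j , refl) | refl = refl
  from∘to : ∀ x → from (to x) ≡ x
  from∘to (j , b) = pull-σ j b (σ-onto (σ j) b)

adjacent⇒Dist1 : ∀ {V} {Adj : V → V → Set} {x y} → ¬ x ≡ y → Adj x y → Dist Adj x y 1
adjacent⇒Dist1 x≢y xy = step xy here , λ where
  ℕ.zero    here → contradiction refl x≢y
  (ℕ.suc _) _    → s≤s z≤n

Dist1⇒adjacent : ∀ {V} {Adj : V → V → Set} {x y} → Dist Adj x y 1 → Adj x y
Dist1⇒adjacent (step xy here , _) = xy

walk⇒first-edge : ∀ {V} {Adj : V → V → Set} {x y n} → ¬ x ≡ y → Walk Adj x y n → ∃[ z ] Adj x z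
walk⇒first-edge x≢y here                = contradiction refl x≢y
walk⇒first-edge _   (step {z = z} xz _) = z , xz

distinct⇒2≤ : ∀ {p} {i j : Fin p} → ¬ i ≡ j → 2 ≤ p
distinct⇒2≤ {1}               {zero} {zero} i≢j = contradiction refl i≢j
distinct⇒2≤ {ℕ.suc (ℕ.suc _)} _                 = s≤s (s≤s z≤n)

module _ {k : ℕ} {m : Fin k → ℕ} (H : Subgraph k m) where
  open Subgraph H using (VH; ends; sub)

  part : HVtx H → Fin k
  part ((i , _) , _) = i

  partSize : Fin k → ℕ
  partSize i = count (λ a → VH (i , a))

  isometric⇒adjacent⇔different-parts :
    Isometric H → ∀ u v → HAdj H (proj₁ u) (proj₁ v) ⇔ (¬ part u ≡ part v)
  isometric⇒adjacent⇔different-parts iso (x , hx) (y , hy) = mk⇔ (sub x y) different⇒adjacent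
    where
    different⇒adjacent : KAdj {k} {m} x y → HAdj H x y
    different⇒adjacent xy =
      Dist1⇒adjacent (Equivalence.from (iso x y hx hy 1) (adjacent⇒Dist1 (xy ∘ cong proj₁) xy))

  isometric⇒multipartite : Isometric H → ∀ {p} (σ : Fin p → Fin k) → Injective _≡_ _≡_ σ →
                           (∀ i → 1 ≤ partSize i → ∃[ j ] σ j ≡ i) → IsoToMultipartite H p (partSize ∘ σ)
  isometric⇒multipartite iso {p} σ σ-injective σ-onto = ↔-sym g , adjacency
    where
    g : KVtx p (partSize ∘ σ) ↔ HVtx H
    g = ↔-trans (Σ-reindex σ σ-injective (λ i a → σ-onto i (m<n⇒0<n (toℕ<n a))))
         (↔-trans (Σ-↔ ↔-refl (↔-sym (enumerate _))) (↔-sym Σ-assoc))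
    part-g : ∀ u → σ (proj₁ (Inverse.from g u)) ≡ part u
    part-g u = cong part (Inverse.strictlyInverseˡ g u)
    adjacency : ∀ u v →
      HAdj H (proj₁ u) (proj₁ v) ⇔ KAdj {p} {partSize ∘ σ} (Inverse.from g u) (Inverse.from g v)
    adjacency u v = ⇔-trans (isometric⇒adjacent⇔different-parts iso u v) (mk⇔
      (λ parts≢ eq → parts≢ (trans (sym (part-g u)) (trans (cong σ eq) (part-g v))))
      (λ indices≢ eq → indices≢ (σ-injective (trans (part-g u) (trans eq (sym (part-g v)))))))

  multipartite⇒2≤parts : Connected H → AtLeastTwoVertices H → ∀ {p n} → IsoToMultipartite H p n → 2 ≤ p
  multipartite⇒2≤parts conn (x , y , x≢y , hx , hy) (_ , adjacency)
    with walk⇒first-edge x≢y (proj₂ (conn x y hx hy))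
  ... | z , xz = distinct⇒2≤ (Equivalence.to (adjacency (x , hx) (z , proj₂ (ends x z xz))) xz)

lemma3p4 : (k : ℕ) → 2 ≤ k → (m : Fin k → ℕ) → NonIncreasing m → (∀ i → 1 ≤ m i) →
    (H : Subgraph k m) → Connected H → AtLeastTwoVertices H → Isometric H →
    ∃[ p ] Σ (Fin p → ℕ) (λ n →
      2 ≤ p × NonIncreasing n × (∀ j → 1 ≤ n j) × IsoToMultipartite H p n ×
      Σ (Fin p → Fin k) (λ ι → StrictlyIncreasing ι × (∀ j → n j ≤ m (ι j))))
lemma3p4 k _ m m-desc _ H conn two iso =
  size , partSize H ∘ index ,
  multipartite⇒2≤parts H conn two H≅K , descending , positive , H≅K ,
  ι , ι-increasing ,
  descending-bound (partSize H ∘ index) m index injective descending m-desc (λ j → count≤ _)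
  where
  open DescendingSupport (descendingSupport (partSize H))
  H≅K : IsoToMultipartite H size (partSize H ∘ index)
  H≅K = isometric⇒multipartite H iso index injective onto
  ι : Fin size → Fin k
  ι j = inject≤ j (injective⇒≤ injective)
  ι-increasing : StrictlyIncreasing ι
  ι-increasing i j = subst₂ _<_ (sym (toℕ-inject≤ i _)) (sym (toℕ-inject≤ j _))
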